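{- If $D$ is a digraph without parallel edges with $\operatorname{bcrk}(\vec{L}(D))\leq k$, then $\operatorname{dbw}(D)\leq 8(1+2^k)$.
   Context: All digraphs are finite and loopless; $\vec{xy}$ denotes the directed edge from $x$ to $y$. A digraph has no parallel edges if no two distinct edges have the same set of endpoints. Directed line-graph: $\vec{L}(D)$ has vertex set $E(D)$ and an edge $\vec{ef}$ whenever there are vertices $w,x,y$ of $D$ with $e=\vec{wx}$ and $f=\vec{xy}$. Layouts: for a finite set $U$ and a symmetric function $f:2^U\to\mathbb{Z}$, a layout of $f$ on $U$ is a pair $(T,\beta)$ with $T$ a tree of maximum degree at most three and $\beta$ a bijection from the leaves of $T$ to $U$. For an edge $xy$ of $T$, with $Y$ the set of leaves in the component of $T-xy$ containing $y$, its order is $f(\beta(Y))$. The width is the maximum order of an edge, and the layout-$f$-width of $U$ is the minimum width of a layout. Directed branch-width: for $B\subseteq E(D)$ let $S_B^V=\{y\in V(D): \exists x,z \text{ with } \vec{xy}\in E(D)\setminus B,\ \vec{yz}\in B\}$. With $f_D(X)=|S_X^V\cup S_{E(D)\setminus X}^V|$, $\operatorname{dbw}(D)$ is the layout-$f_D$-width of $E(D)$. Bi-cut-rank-width: with $M$ the adjacency matrix of a digraph $G$ over $\mathbb{GF}(2)$ and $g(X)=\operatorname{rk}(M[V(G)\setminus X,X])+\operatorname{rk}(M[X,V(G)\setminus X])$, $\operatorname{bcrk}(G)$ is the layout-$g$-width of $V(G)$. -}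

module Defs where

open import Data.Nat using (ℕ; zero; suc; _+_; _*_; _^_; _≤_; _⊔_)
open import Data.Bool using (Bool; true; false; _∧_; _∨_; not; if_then_else_; _xor_)
open import Data.Fin using (Fin; zero; suc; _≟_)
open import Data.Product using (Σ; _×_; _,_; proj₁; ∃)
open import Data.Sum using (_⊎_)
open import Data.Vec.Functional using (_∷_)
open import Function using (_∘_; _⇔_)
open import Function.Bundles using (_⤖_; Bijection)
open import Relation.Binary.PropositionalEquality using (_≡_; _≢_)
open import Relation.Nullary using (¬_)
open import Relation.Nullary.Decidable using (⌊_⌋)

Sub : ℕ → Set
Sub n = Fin n → Bool

count : ∀ {n} → Sub n → ℕ
count {zero}  S = 0
count {suc n} S = (if S zero then 1 else 0) + count (S ∘ suc)

anyF : ∀ {n} → (Fin n → Bool) → Bool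
anyF {zero}  S = false
anyF {suc n} S = S zero ∨ anyF (S ∘ suc)

xorSum : ∀ {n} → (Fin n → Bool) → Bool
xorSum {zero}  S = false
xorSum {suc n} S = S zero xor xorSum (S ∘ suc)

compl : ∀ {n} → Sub n → Sub n
compl S i = not (S i)

subsetB : ∀ {n} → Sub n → Sub n → Bool
subsetB S T = not (anyF (λ i → S i ∧ not (T i)))

maxSub : ∀ n → (Sub n → ℕ) → ℕ
maxSub zero    h = h (λ ())
maxSub (suc n) h = maxSub n (λ S → h (false ∷ S)) ⊔ maxSub n (λ S → h (true ∷ S))

allSub : ∀ n → (Sub n → Bool) → Bool
allSub zero    h = h (λ ())
allSub (suc n) h = allSub n (λ S → h (false ∷ S)) ∧ allSub n (λ S → h (true ∷ S))

-- Rank over GF(2) of the submatrix M[R, C] (rows R, columns C) of a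
-- square 0/1 matrix M : Fin n → Fin n → Bool, defined as the maximum
-- number of columns of M[R,C] that are linearly independent over GF(2).

-- the column set S is GF(2)-linearly independent in M[R, -]:
-- every nonempty T ⊆ S has a nonzero sum of columns (restricted to rows R)
indepCols : ∀ {n} → (Fin n → Fin n → Bool) → Sub n → Sub n → Bool
indepCols {n} M R S =
  allSub n (λ T → not (subsetB T S ∧ anyF T)
                  ∨ anyF (λ i → R i ∧ xorSum (λ c → T c ∧ M i c)))

rank : ∀ {n} → (Fin n → Fin n → Bool) → Sub n → Sub n → ℕ
rank {n} M R C =
  maxSub n (λ S → if subsetB S C ∧ indepCols M R S then count S else 0)

data Walk {t : ℕ} (A : Fin t → Fin t → Bool) : Fin t → Fin t → Set where
  here : ∀ {u} → Walk A u u
  step : ∀ {u v w} → A u v ≡ true → Walk A v w → Walk A u w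

eqB : ∀ {t} → Fin t → Fin t → Bool
eqB u v = ⌊ u ≟ v ⌋

deleteEdge : ∀ {t} → (Fin t → Fin t → Bool) → Fin t → Fin t → Fin t → Fin t → Bool
deleteEdge A x y u v =
  A u v ∧ not ((eqB u x ∧ eqB v y) ∨ (eqB u y ∧ eqB v x))

record SubcubicTree : Set where
  field
    size       : ℕ
    adj        : Fin size → Fin size → Bool
    adj-sym    : ∀ u v → adj u v ≡ adj v u
    adj-irrefl : ∀ u → adj u u ≡ false
    connected  : ∀ u v → Walk adj u v
    -- no cycles: for no edge uv is there a u–v walk avoiding uv
    acyclic    : ∀ u v → adj u v ≡ true → ¬ Walk (deleteEdge adj u v) u v
    max-deg    : ∀ u → count (adj u) ≤ 3

  IsLeaf : Fin size → Set
  IsLeaf u = count (adj u) ≤ 1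

  Leaf : Set
  Leaf = Σ (Fin size) IsLeaf

record Layout (m : ℕ) : Set where
  field
    tree : SubcubicTree
  open SubcubicTree tree public
  field
    β : Leaf ⤖ Fin m

  β-to : Leaf → Fin m
  β-to = Bijection.to β

  -- X is (the characteristic function of) β(Y), where Y is the set of
  -- leaves in the component of T - xy containing y
  Side : Fin size → Fin size → Sub m → Set
  Side x y X = ∀ u → (X u ≡ true) ⇔
    (Σ Leaf λ ℓ → Walk (deleteEdge adj x y) y (proj₁ ℓ) × β-to ℓ ≡ u)

LayoutWidth≤ : ∀ {m} → (Sub m → ℕ) → Layout m → ℕ → Set
LayoutWidth≤ f L k = ∀ x y → adj x y ≡ true → ∀ X → Side x y X → f X ≤ k
  where open Layout L

LayoutFWidth≤ : ∀ {m} → (Sub m → ℕ) → ℕ → Set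
LayoutFWidth≤ {m} f k = Σ (Layout m) λ L → LayoutWidth≤ f L k

record Digraph : Set where
  field
    n    : ℕ
    m    : ℕ
    tail : Fin m → Fin n
    head : Fin m → Fin n
open Digraph public

Loopless : Digraph → Set
Loopless D = ∀ e → tail D e ≢ head D e

NoParallelEdges : Digraph → Set
NoParallelEdges D = ∀ e e' → e ≢ e' →
  ¬ ((tail D e ≡ tail D e' × head D e ≡ head D e')
     ⊎ (tail D e ≡ head D e' × head D e ≡ tail D e'))

-- directed line graph, given by its adjacency matrix over GF(2):
-- e → f iff e = wx and f = xy
lineAdj : (D : Digraph) → Fin (m D) → Fin (m D) → Bool
lineAdj D e f = eqB (head D e) (tail D f)

SV : (D : Digraph) → Sub (m D) → Sub (n D)
SV D B y = anyF (λ e → not (B e) ∧ eqB (head D e) y)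
         ∧ anyF (λ f → B f ∧ eqB (tail D f) y)

fD : (D : Digraph) → Sub (m D) → ℕ
fD D X = count (λ y → SV D X y ∨ SV D (compl X) y)

dbw≤ : Digraph → ℕ → Set
dbw≤ D k = LayoutFWidth≤ (fD D) k

cutRankG : ∀ {N} → (Fin N → Fin N → Bool) → Sub N → ℕ
cutRankG M X = rank M (compl X) X + rank M X (compl X)

bcrk≤ : ∀ {N} → (Fin N → Fin N → Bool) → ℕ → Set
bcrk≤ M k = LayoutFWidth≤ (cutRankG M) k

module Submission where

open import Defs
open import Data.Nat using (ℕ; zero; suc; _+_; _*_; _^_; _≤_; z≤n; s≤s)
open import Data.Nat.Properties
  using (≤-reflexive; ≤-trans; +-mono-≤; +-monoʳ-≤; +-suc; +-identityʳ; n≤1+n; m≤m⊔n; m≤n⊔m; m^n>0; m≤n*m)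
open import Data.Bool using (Bool; true; false; _∧_; _∨_; not; if_then_else_; T)
open import Data.Bool.Properties using (∨-zeroʳ; not-involutive; ¬-not)
open import Data.Unit using (tt)
open import Data.Fin using (Fin; zero; suc; _≟_)
open import Data.Fin.Properties using (suc-injective)
open import Data.Product using (Σ; _×_; _,_; proj₁; proj₂)
open import Data.Vec.Functional using (_∷_)
open import Function using (_∘_; case_of_)
open import Relation.Binary.PropositionalEquality
open import Relation.Nullary.Decidable using (dec-true; dec-false; isYes≗does; ⌊⌋-map′; toWitness)

-- For a vertex y with an in-edge outside X and an out-edge in X,
-- pick one out-edge of y in X. The picked edges have pairwise distinct tails,
-- so each has a private row in the line graph, namely an edge outside X ending
-- at its tail; columns with private rows are independent over GF(2). Hence
-- |S^V_X| ≤ rk M[E ∖ X, X], and symmetrically, so f_D ≤ g pointwise and every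
-- layout witnessing bcrk(L(D)) ≤ k witnesses dbw(D) ≤ k ≤ 8(1 + 2^k).

∧-true⁻ : ∀ {a b} → a ∧ b ≡ true → a ≡ true × b ≡ true
∧-true⁻ {true} b≡true = refl , b≡true

∧-true⁺ : ∀ {a b} → a ≡ true → b ≡ true → a ∧ b ≡ true
∧-true⁺ refl refl = refl

eqB⇒≡ : ∀ {t} {u v : Fin t} → eqB u v ≡ true → u ≡ v
eqB⇒≡ u=ᵇv = toWitness (subst T (sym u=ᵇv) tt)

≡⇒eqB : ∀ {t} {u v : Fin t} → u ≡ v → eqB u v ≡ true
≡⇒eqB {u = u} {v} u≡v = trans (isYes≗does (u ≟ v)) (dec-true (u ≟ v) u≡v)

≢⇒eqB-false : ∀ {t} {u v : Fin t} → u ≢ v → eqB u v ≡ false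
≢⇒eqB-false {u = u} {v} u≢v = trans (isYes≗does (u ≟ v)) (dec-false (u ≟ v) u≢v)

eqB-suc : ∀ {t} (i j : Fin t) → eqB (suc i) (suc j) ≡ eqB i j
eqB-suc i j = ⌊⌋-map′ _ _ (i ≟ j)

anyF-true⁺ : ∀ {n} (S : Sub n) i → S i ≡ true → anyF S ≡ true
anyF-true⁺ S zero    Si rewrite Si = refl
anyF-true⁺ S (suc i) Si rewrite anyF-true⁺ (S ∘ suc) i Si = ∨-zeroʳ (S zero)

anyF-true⁻ : ∀ {n} (S : Sub n) → anyF S ≡ true → Σ (Fin n) λ i → S i ≡ true
anyF-true⁻ {suc n} S any with S zero in S0
... | true  = zero , S0
... | false with anyF-true⁻ (S ∘ suc) any
...   | i , Si = suc i , Si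

anyF-false⁺ : ∀ {n} (S : Sub n) → (∀ i → S i ≡ false) → anyF S ≡ false
anyF-false⁺ {zero}  S none = refl
anyF-false⁺ {suc n} S none rewrite none zero = anyF-false⁺ (S ∘ suc) (none ∘ suc)

xorSum-false⁺ : ∀ {n} (F : Sub n) → (∀ i → F i ≡ false) → xorSum F ≡ false
xorSum-false⁺ {zero}  F none = refl
xorSum-false⁺ {suc n} F none rewrite none zero = xorSum-false⁺ (F ∘ suc) (none ∘ suc)

xorSum-single : ∀ {n} (F : Sub n) c → F c ≡ true → (∀ c′ → F c′ ≡ true → c′ ≡ c) →
                xorSum F ≡ true
xorSum-single F zero Fc only
  rewrite Fc | xorSum-false⁺ (F ∘ suc) (λ i → ¬-not (λ Fi → case only (suc i) Fi of λ ())) = refl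
xorSum-single F (suc c) Fc only
  rewrite ¬-not {F zero} (λ F0 → case only zero F0 of λ ()) =
  xorSum-single (F ∘ suc) c Fc (λ c′ Fc′ → suc-injective (only (suc c′) Fc′))

_⊆_ : ∀ {n} → Sub n → Sub n → Set
S ⊆ T = ∀ i → S i ≡ true → T i ≡ true

⊆⇒subsetB : ∀ {n} (S T : Sub n) → S ⊆ T → subsetB S T ≡ true
⊆⇒subsetB S T S⊆T = cong not (anyF-false⁺ _ outside)
  where
  outside : ∀ i → S i ∧ not (T i) ≡ false
  outside i with S i in Si
  ... | false = refl
  ... | true rewrite S⊆T i Si = refl

subsetB⇒⊆ : ∀ {n} (S T : Sub n) → subsetB S T ≡ true → S ⊆ T
subsetB⇒⊆ S T subset i Si with T i in Ti
... | true  = refl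
... | false = case trans (cong not (sym (anyF-true⁺ _ i (∧-true⁺ Si (cong not Ti))))) subset of λ ()

count-cong : ∀ {n} {S T : Sub n} → S ≗ T → count S ≡ count T
count-cong {zero}  S≗T = refl
count-cong {suc n} S≗T rewrite S≗T zero = cong (_ +_) (count-cong (S≗T ∘ suc))

count-∨ : ∀ {n} (A B : Sub n) → count (λ i → A i ∨ B i) ≤ count A + count B
count-∨ {zero}  A B = z≤n
count-∨ {suc n} A B with A zero | B zero | count-∨ (A ∘ suc) (B ∘ suc)
... | true  | true  | ih = s≤s (≤-trans ih (+-monoʳ-≤ (count (A ∘ suc)) (n≤1+n _)))
... | true  | false | ih = s≤s ih
... | false | true  | ih rewrite +-suc (count (A ∘ suc)) (count (B ∘ suc)) = s≤s ih
... | false | false | ih = ih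

count-remove : ∀ {n} (Q : Sub n) i → Q i ≡ true →
               count Q ≡ suc (count (λ j → Q j ∧ not (eqB j i)))
count-remove Q zero Q0 rewrite Q0 = cong suc (count-cong keep)
  where
  keep : ∀ j → Q (suc j) ≡ Q (suc j) ∧ true
  keep j with Q (suc j)
  ... | true  = refl
  ... | false = refl
count-remove Q (suc i) Qi
  rewrite count-remove (Q ∘ suc) i Qi
        | count-cong {T = λ j → Q (suc j) ∧ not (eqB j i)}
                     (λ j → cong (λ b → Q (suc j) ∧ not b) (eqB-suc j i))
  with Q zero
... | true  = refl
... | false = refl

count-≤-injection : ∀ {n m} (P : Sub n) (Q : Sub m) (φ : ∀ y → P y ≡ true → Fin m) →
                    (∀ y p → Q (φ y p) ≡ true) →
                    (∀ y y′ p p′ → φ y p ≡ φ y′ p′ → y ≡ y′) → count P ≤ count Q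
count-≤-injection {zero} P Q φ φ∈Q φ-inj = z≤n
count-≤-injection {suc n} P Q φ φ∈Q φ-inj with P zero in P0
... | false = count-≤-injection (P ∘ suc) Q (φ ∘ suc) (φ∈Q ∘ suc)
                (λ y y′ p p′ → suc-injective ∘ φ-inj _ _ p p′)
... | true rewrite count-remove Q (φ zero P0) (φ∈Q zero P0) =
  s≤s (count-≤-injection (P ∘ suc) _ (φ ∘ suc) avoids-φ0
         (λ y y′ p p′ → suc-injective ∘ φ-inj _ _ p p′))
  where
  avoids-φ0 : ∀ y p → Q (φ (suc y) p) ∧ not (eqB (φ (suc y) p) (φ zero P0)) ≡ true
  avoids-φ0 y p = ∧-true⁺ (φ∈Q (suc y) p)
    (cong not (≢⇒eqB-false (λ eq → case φ-inj _ _ p P0 eq of λ ())))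

isFirst : ∀ {n} → Sub n → Sub n
isFirst P zero    = P zero
isFirst P (suc i) = not (P zero) ∧ isFirst (P ∘ suc) i

isFirst⊆ : ∀ {n} (P : Sub n) → isFirst P ⊆ P
isFirst⊆ P zero    first = first
isFirst⊆ P (suc i) first = isFirst⊆ (P ∘ suc) i (proj₂ (∧-true⁻ first))

isFirst-unique : ∀ {n} (P : Sub n) i j → isFirst P i ≡ true → isFirst P j ≡ true → i ≡ j
isFirst-unique P zero    zero    _ _ = refl
isFirst-unique P zero    (suc j) P0 first rewrite P0 = case first of λ ()
isFirst-unique P (suc i) zero    first P0 rewrite P0 = case first of λ ()
isFirst-unique P (suc i) (suc j) first first′ =
  cong suc (isFirst-unique (P ∘ suc) i j (proj₂ (∧-true⁻ first)) (proj₂ (∧-true⁻ first′)))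

isFirst-exists : ∀ {n} (P : Sub n) i → P i ≡ true → Σ (Fin n) λ j → isFirst P j ≡ true
isFirst-exists P zero    Pi = zero , Pi
isFirst-exists P (suc i) Pi with P zero in P0
... | true  = zero , P0
... | false with isFirst-exists (P ∘ suc) i Pi
... | j , first = suc j , ∧-true⁺ (cong not P0) first

allSub-true⁺ : ∀ n (h : Sub n → Bool) → (∀ T → h T ≡ true) → allSub n h ≡ true
allSub-true⁺ zero    h all = all _
allSub-true⁺ (suc n) h all =
  ∧-true⁺ (allSub-true⁺ n _ (all ∘ (false ∷_))) (allSub-true⁺ n _ (all ∘ (true ∷_)))

-- maxSub evaluates h only on vectors built with _∷_, which agree with S
-- pointwise but not definitionally; hence the hypothesis quantifies over S′ ≗ S.
≤-maxSub : ∀ n (h : Sub n → ℕ) (S : Sub n) k → (∀ S′ → S′ ≗ S → k ≤ h S′) → k ≤ maxSub n h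
≤-maxSub zero    h S k bound = bound _ (λ ())
≤-maxSub (suc n) h S k bound with S zero in S0
... | false = ≤-trans (≤-maxSub n _ (S ∘ suc) k
                (λ S′ S′≗S → bound (false ∷ S′) λ { zero → sym S0 ; (suc i) → S′≗S i }))
                (m≤m⊔n _ _)
... | true  = ≤-trans (≤-maxSub n _ (S ∘ suc) k
                (λ S′ S′≗S → bound (true ∷ S′) λ { zero → sym S0 ; (suc i) → S′≗S i }))
                (m≤n⊔m _ _)

HasPrivateRows : ∀ {n} → (Fin n → Fin n → Bool) → Sub n → Sub n → Set
HasPrivateRows {n} M R S = ∀ c → S c ≡ true →
  Σ (Fin n) λ r → R r ≡ true × M r c ≡ true × (∀ c′ → S c′ ≡ true → M r c′ ≡ true → c′ ≡ c)

HasPrivateRows-⊆ : ∀ {n} (M : Fin n → Fin n → Bool) R {S S′ : Sub n} →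
                   S′ ⊆ S → HasPrivateRows M R S → HasPrivateRows M R S′
HasPrivateRows-⊆ M R S′⊆S private-S c S′c with private-S c (S′⊆S c S′c)
... | r , Rr , Mrc , only = r , Rr , Mrc , λ c′ S′c′ → only c′ (S′⊆S c′ S′c′)

privateRows⇒indepCols : ∀ {n} (M : Fin n → Fin n → Bool) R S →
                        HasPrivateRows M R S → indepCols M R S ≡ true
privateRows⇒indepCols {n} M R S private-S = allSub-true⁺ n _ nonzeroSum
  where
  nonzeroSum : ∀ T → (not (subsetB T S ∧ anyF T)
                      ∨ anyF (λ r → R r ∧ xorSum (λ c → T c ∧ M r c))) ≡ true
  nonzeroSum T with subsetB T S in T⊆S | anyF T in T≢∅
  ... | false | _     = refl
  ... | true  | false = refl
  ... | true  | true  with anyF-true⁻ T T≢∅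
  ...   | c , Tc with private-S c (subsetB⇒⊆ T S T⊆S c Tc)
  ...     | r , Rr , Mrc , only =
    anyF-true⁺ _ r (∧-true⁺ Rr (xorSum-single _ c (∧-true⁺ Tc Mrc) λ c′ TMc′ →
      let Tc′ , Mrc′ = ∧-true⁻ TMc′ in only c′ (subsetB⇒⊆ T S T⊆S c′ Tc′) Mrc′))

privateRows⇒count≤rank : ∀ {n} (M : Fin n → Fin n → Bool) R C S →
                         S ⊆ C → HasPrivateRows M R S → count S ≤ rank M R C
privateRows⇒count≤rank {n} M R C S S⊆C private-S = ≤-maxSub n _ S (count S) bound
  where
  bound : ∀ S′ → S′ ≗ S → count S ≤ (if subsetB S′ C ∧ indepCols M R S′ then count S′ else 0)
  bound S′ S′≗S
    rewrite ⊆⇒subsetB S′ C (λ i → S⊆C i ∘ trans (sym (S′≗S i)))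
          | privateRows⇒indepCols M R S′
              (HasPrivateRows-⊆ M R (λ i → trans (sym (S′≗S i))) private-S)
    = ≤-reflexive (count-cong (sym ∘ S′≗S))

-- S^V_B is the set of junctions for R = E ∖ B and C = B.
Junction : (D : Digraph) → Sub (m D) → Sub (m D) → Fin (n D) → Set
Junction D R C y = (Σ (Fin (m D)) λ e → R e ≡ true × head D e ≡ y)
                 × (Σ (Fin (m D)) λ f → C f ≡ true × tail D f ≡ y)

Junction-monoˡ : ∀ D {R R′ C y} → R ⊆ R′ → Junction D R C y → Junction D R′ C y
Junction-monoˡ D R⊆R′ ((e , Re , he) , out) = (e , R⊆R′ e Re , he) , out

module _ (D : Digraph) (R C : Sub (m D)) (P : Sub (n D))
         (junction : ∀ y → P y ≡ true → Junction D R C y) where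

  outEdgeIn-C : Fin (n D) → Sub (m D)
  outEdgeIn-C y f = C f ∧ eqB (tail D f) y

  representative : Sub (m D)
  representative f = P (tail D f) ∧ isFirst (outEdgeIn-C (tail D f)) f

  representative⊆C : representative ⊆ C
  representative⊆C f rep =
    proj₁ (∧-true⁻ (isFirst⊆ (outEdgeIn-C (tail D f)) f (proj₂ (∧-true⁻ rep))))

  representative-tail-injective : ∀ f f′ → representative f ≡ true →
    representative f′ ≡ true → tail D f ≡ tail D f′ → f ≡ f′
  representative-tail-injective f f′ rep rep′ same-tail =
    isFirst-unique (outEdgeIn-C (tail D f′)) f f′
      (subst (λ y → isFirst (outEdgeIn-C y) f ≡ true) same-tail (proj₂ (∧-true⁻ rep)))
      (proj₂ (∧-true⁻ rep′))

  representative-privateRows : HasPrivateRows (lineAdj D) R representative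
  representative-privateRows c rep with proj₁ (junction (tail D c) (proj₁ (∧-true⁻ rep)))
  ... | e , Re , e↦c = e , Re , ≡⇒eqB e↦c , λ c′ rep′ e→c′ →
    representative-tail-injective c′ c rep′ rep (trans (sym (eqB⇒≡ e→c′)) e↦c)

  pick : ∀ y → P y ≡ true → Σ (Fin (m D)) λ f → isFirst (outEdgeIn-C y) f ≡ true
  pick y Py with proj₂ (junction y Py)
  ... | f , Cf , f↤y = isFirst-exists (outEdgeIn-C y) f (∧-true⁺ Cf (≡⇒eqB f↤y))

  pick-tail : ∀ y Py → tail D (proj₁ (pick y Py)) ≡ y
  pick-tail y Py = eqB⇒≡ (proj₂ (∧-true⁻ (isFirst⊆ (outEdgeIn-C y) _ (proj₂ (pick y Py)))))

  pick-representative : ∀ y Py → representative (proj₁ (pick y Py)) ≡ true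
  pick-representative y Py rewrite pick-tail y Py = ∧-true⁺ Py (proj₂ (pick y Py))

  count-junctions≤rank : count P ≤ rank (lineAdj D) R C
  count-junctions≤rank = ≤-trans
    (count-≤-injection P representative (λ y → proj₁ ∘ pick y) pick-representative
       (λ y y′ Py Py′ same → trans (sym (pick-tail y Py))
                               (trans (cong (tail D) same) (pick-tail y′ Py′))))
    (privateRows⇒count≤rank (lineAdj D) R C representative
       representative⊆C representative-privateRows)

SV⇒Junction : ∀ D B y → SV D B y ≡ true → Junction D (compl B) B y
SV⇒Junction D B y sv
  with anyF-true⁻ _ (proj₁ (∧-true⁻ sv)) | anyF-true⁻ _ (proj₂ (∧-true⁻ sv))
... | e , in-e | f , out-f =
  let ¬Be , e↦y = ∧-true⁻ in-e ; Bf , f↤y = ∧-true⁻ out-f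
  in (e , ¬Be , eqB⇒≡ e↦y) , (f , Bf , eqB⇒≡ f↤y)

fD≤cutRankG : ∀ D X → fD D X ≤ cutRankG (lineAdj D) X
fD≤cutRankG D X = ≤-trans (count-∨ (SV D X) (SV D (compl X)))
  (+-mono-≤ (count-junctions≤rank D (compl X) X (SV D X) (SV⇒Junction D X))
            (count-junctions≤rank D X (compl X) (SV D (compl X)) λ y sv →
               Junction-monoˡ D (λ e Xe → trans (sym (not-involutive (X e))) Xe)
                 (SV⇒Junction D (compl X) y sv)))

LayoutFWidth≤-mono : ∀ {m} {f g : Sub m → ℕ} {k l} → (∀ X → f X ≤ g X) → k ≤ l →
                     LayoutFWidth≤ g k → LayoutFWidth≤ f l
LayoutFWidth≤-mono f≤g k≤l (L , width) =
  L , λ x y xy X side → ≤-trans (f≤g X) (≤-trans (width x y xy X side) k≤l)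

n≤2^n : ∀ n → n ≤ 2 ^ n
n≤2^n zero    = z≤n
n≤2^n (suc n) rewrite +-identityʳ (2 ^ n) = +-mono-≤ (m^n>0 2 n) (n≤2^n n)

mainTheorem14 : (D : Digraph) (k : ℕ) → Loopless D → NoParallelEdges D →
                  bcrk≤ (lineAdj D) k → dbw≤ D (8 * (1 + 2 ^ k))
mainTheorem14 D k _ _ = LayoutFWidth≤-mono (fD≤cutRankG D)
  (≤-trans (n≤2^n k) (≤-trans (n≤1+n _) (m≤n*m (1 + 2 ^ k) 8)))
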